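{- Let $s=1+m(q-1)$ with $m\geq1$. For all $d\geq m$, $$\frac{\widetilde\pi_d}{\omega_{d-m}(t_1)\cdots\omega_{d-m}(t_s)}=-(-\theta)^{\delta_{s,d}-m+1}\frac{b_{d-m}(t_1)\cdots b_{d-m}(t_s)}{l_{d-1}}.$$
   Context: $A=\mathbb F_q[\theta]$, $K=\mathbb F_q(\theta)$, and a $(q-1)$-th root $(-\theta)^{1/(q-1)}$ of $-\theta$ is fixed. $\widetilde\pi_d=\theta(-\theta)^{1/(q-1)}\prod_{i=1}^{d-1}(1-\theta/\theta^{q^i})^{ -1}$ and $\omega_d(t)=(-\theta)^{1/(q-1)}\prod_{i=0}^{d-1}(1-t/\theta^{q^i})^{ -1}$. $b_0=1$, $b_i(Y)=\prod_{k=0}^{i-1}(Y-\theta^{q^k})$; $l_0=1$, $l_d=\prod_{k=1}^d(\theta-\theta^{q^k})$. $\delta_{s,d}=\frac{q^d-q}{q-1}-s\frac{q^{d-m}-1}{q-1}$ (an integer). -}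

module Defs where

open import Level using (Level; _⊔_) renaming (suc to lsuc)
open import Data.Nat as ℕ using (ℕ; zero; suc; _∸_)
open import Data.Integer as ℤ using (ℤ; +_; -[1+_])
open import Data.Fin as Fin using (Fin)
open import Relation.Nullary using (¬_)
open import Algebra.Bundles using (CommutativeRing)

record Field (c ℓ : Level) : Set (lsuc (c ⊔ ℓ)) where
  field
    commutativeRing : CommutativeRing c ℓ
  open CommutativeRing commutativeRing public
  field
    _⁻¹     : Carrier → Carrier
    ⁻¹-inverse : ∀ x → ¬ (x ≈ 0#) → (x * (x ⁻¹)) ≈ 1#
    0≉1     : ¬ (0# ≈ 1#)

  infixl 7 _/_
  _/_ : Carrier → Carrier → Carrier
  x / y = x * (y ⁻¹)

  _^_ : Carrier → ℕ → Carrier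
  x ^ zero  = 1#
  x ^ suc n = x * (x ^ n)

  _^ℤ_ : Carrier → ℤ → Carrier
  x ^ℤ (+ n)     = x ^ n
  x ^ℤ -[1+ n ]  = (x ^ suc n) ⁻¹

  ι : ℕ → Carrier
  ι zero    = 0#
  ι (suc n) = 1# + ι n

  ∏from : ℕ → ℕ → (ℕ → Carrier) → Carrier
  ∏from a zero    f = 1#
  ∏from a (suc n) f = f a * ∏from (suc a) n f

  -- ∏_{i = lo}^{hi - 1} f i  (empty if hi ≤ lo)
  ∏[_,_⟩ : ℕ → ℕ → (ℕ → Carrier) → Carrier
  ∏[ lo , hi ⟩ f = ∏from lo (hi ∸ lo) f

  ∏Fin : (n : ℕ) → (Fin n → Carrier) → Carrier
  ∏Fin zero    f = 1#
  ∏Fin (suc n) f = f Fin.zero * ∏Fin n (λ j → f (Fin.suc j))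

-- natural-number division, with the (unused) convention a / 0 = 0
_div_ : ℕ → ℕ → ℕ
a div zero  = 0
a div suc b = a ℕ./ suc b

δ : (q m s d : ℕ) → ℤ
δ q m s d = (+ ((q ℕ.^ d ∸ q) div (q ∸ 1))) ℤ.- (+ (s ℕ.* ((q ℕ.^ (d ∸ m) ∸ 1) div (q ∸ 1))))

-- The objects of the paper, in a field F, with θ, a chosen (q-1)-th root
-- ρ = (-θ)^{1/(q-1)}.
module Objects {c ℓ} (F : Field c ℓ) (q : ℕ) (θ ρ : Field.Carrier F) where
  open Field F

  θq : ℕ → Carrier
  θq i = θ ^ (q ℕ.^ i)

  π̃ : ℕ → Carrier
  π̃ d = (θ * ρ) * ∏[ 1 , d ⟩ (λ i → (1# - θ / θq i) ⁻¹)

  ω : ℕ → Carrier → Carrier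
  ω d t = ρ * ∏[ 0 , d ⟩ (λ i → (1# - t / θq i) ⁻¹)

  b : ℕ → Carrier → Carrier
  b i Y = ∏[ 0 , i ⟩ (λ k → Y - θq k)

  l : ℕ → Carrier
  l d = ∏[ 1 , suc d ⟩ (λ k → θ - θq k)

{-# OPTIONS --safe #-}
-- Each factor satisfies (1 - t/θ^{q^i})⁻¹ (t - θ^{q^i}) = -θ^{q^i} = (-θ)^{q^i}, the last step
-- because (-1)^q = -1 (q is odd, or the characteristic is 2). Multiplying out,
-- ω_n(t) b_n(t) = ρ (-θ)^{(q^n-1)/(q-1)} and π̃_d l_{d-1} = -ρ (-θ)^{1+(q^d-q)/(q-1)}, while
-- ρ^s = ρ (-θ)^m because ρ^{q-1} = -θ. After clearing denominators the two sides differ only in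
-- the exponent of -θ, and the exponents agree by the definition of δ_{s,d}.
module Submission where

open import Defs
open import Data.Nat as ℕ using (ℕ; zero; suc; _∸_; _≤_; _<_; z≤n; s≤s; NonZero)
import Data.Nat.Properties as ℕₚ
open import Data.Nat.DivMod using (m*n/n≡m)
open import Data.Nat.Divisibility using (_∣_; divides)
open import Data.Nat.Primality using (Prime; prime; prime⇒nonZero; prime⇒irreducible)
open import Data.Nat.Solver using (module +-*-Solver)
open import Data.Integer as ℤ using (ℤ; +_; -[1+_])
import Data.Integer.Properties as ℤₚ
import Data.Integer.Solver as ℤ-Solver
open import Data.Fin as Fin using (Fin)
open import Data.Product using (∃; _,_; _×_)
open import Data.Sum using (_⊎_; inj₁; inj₂)
open import Function using (_∘_)
open import Relation.Nullary using (¬_)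
open import Relation.Binary.PropositionalEquality as ≡ using (_≡_)
import Algebra.Properties.Ring as RingProperties
import Algebra.Properties.CommutativeSemigroup as CommutativeSemigroupProperties
import Algebra.Properties.CommutativeSemiring.Exp as CommutativeSemiringExp

Σfrom : ℕ → ℕ → (ℕ → ℕ) → ℕ
Σfrom a zero    f = 0
Σfrom a (suc n) f = f a ℕ.+ Σfrom (suc a) n f

geometricSum : ∀ q .{{_ : NonZero q}} a k →
               Σfrom a k (q ℕ.^_) ℕ.* (q ∸ 1) ℕ.+ q ℕ.^ a ≡ q ℕ.^ (a ℕ.+ k)
geometricSum q@(suc r) a zero    = ≡.cong (q ℕ.^_) (≡.sym (ℕₚ.+-identityʳ a))
geometricSum q@(suc r) a (suc k) = begin
  (q ℕ.^ a ℕ.+ S) ℕ.* r ℕ.+ q ℕ.^ a  ≡⟨ solve 3 (λ r x S → (x :+ S) :* r :+ x := S :* r :+ (x :+ r :* x)) ≡.refl r (q ℕ.^ a) S ⟩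
  S ℕ.* r ℕ.+ q ℕ.^ suc a            ≡⟨ geometricSum q (suc a) k ⟩
  q ℕ.^ (suc a ℕ.+ k)                ≡⟨ ≡.cong (q ℕ.^_) (≡.sym (ℕₚ.+-suc a k)) ⟩
  q ℕ.^ (a ℕ.+ suc k)                ∎
  where
  open ≡.≡-Reasoning
  open +-*-Solver
  S : ℕ
  S = Σfrom (suc a) k (q ℕ.^_)

geometricSum-div : ∀ {q} → 2 ≤ q → ∀ a k →
                   (q ℕ.^ (a ℕ.+ k) ∸ q ℕ.^ a) div (q ∸ 1) ≡ Σfrom a k (q ℕ.^_)
geometricSum-div {q@(suc (suc r))} (s≤s (s≤s z≤n)) a k = begin
  (q ℕ.^ (a ℕ.+ k) ∸ q ℕ.^ a) ℕ./ suc r           ≡⟨ ≡.cong (λ x → (x ∸ q ℕ.^ a) ℕ./ suc r) (≡.sym (geometricSum q a k)) ⟩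
  (S ℕ.* suc r ℕ.+ q ℕ.^ a ∸ q ℕ.^ a) ℕ./ suc r   ≡⟨ ≡.cong (ℕ._/ suc r) (ℕₚ.m+n∸n≡m (S ℕ.* suc r) (q ℕ.^ a)) ⟩
  S ℕ.* suc r ℕ./ suc r                           ≡⟨ m*n/n≡m S (suc r) ⟩
  S                                               ∎
  where
  open ≡.≡-Reasoning
  S : ℕ
  S = Σfrom a k (q ℕ.^_)

-- By the geometric sum formula, δ_{s,d} = S₁ - s S₀ with S₁ = Σ_{i=1}^{d-1} q^i and S₀ = Σ_{i=0}^{d-m-1} q^i.
δ-exponent : ∀ {q} → 2 ≤ q → ∀ m s d → 1 ≤ d →
  (δ q m s d ℤ.- + m) ℤ.+ + 1 ℤ.+ + (m ℕ.+ s ℕ.* Σfrom 0 (d ∸ m) (q ℕ.^_))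
    ≡ + suc (Σfrom 1 (d ∸ 1) (q ℕ.^_))
δ-exponent {q} q≥2 m s d d≥1 = begin
  (δ q m s d ℤ.- + m) ℤ.+ + 1 ℤ.+ + (m ℕ.+ s ℕ.* S₀)
    ≡⟨ ≡.cong₂ (λ A B → (+ A ℤ.- + (s ℕ.* B) ℤ.- + m) ℤ.+ + 1 ℤ.+ + (m ℕ.+ s ℕ.* S₀)) S₁-div S₀-div ⟩
  (+ S₁ ℤ.- + (s ℕ.* S₀) ℤ.- + m) ℤ.+ + 1 ℤ.+ (+ m ℤ.+ + (s ℕ.* S₀))
    ≡⟨ solve 3 (λ A B M → A :- B :- M :+ con (+ 1) :+ (M :+ B) := con (+ 1) :+ A) ≡.refl (+ S₁) (+ (s ℕ.* S₀)) (+ m) ⟩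
  + suc S₁ ∎
  where
  open ≡.≡-Reasoning
  open ℤ-Solver.+-*-Solver
  S₁ S₀ : ℕ
  S₁ = Σfrom 1 (d ∸ 1) (q ℕ.^_)
  S₀ = Σfrom 0 (d ∸ m) (q ℕ.^_)
  S₁-div : (q ℕ.^ d ∸ q) div (q ∸ 1) ≡ S₁
  S₁-div = ≡.trans (≡.cong₂ (λ x y → (q ℕ.^ x ∸ y) div (q ∸ 1)) (≡.sym (ℕₚ.m+[n∸m]≡n d≥1)) (≡.sym (ℕₚ.*-identityʳ q)))
                 (geometricSum-div q≥2 1 (d ∸ 1))
  S₀-div : (q ℕ.^ (d ∸ m) ∸ 1) div (q ∸ 1) ≡ S₀
  S₀-div = geometricSum-div q≥2 0 (d ∸ m)

even⊎odd : ∀ n → 2 ∣ n ⊎ ∃ λ k → n ≡ suc (k ℕ.* 2)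
even⊎odd zero = inj₁ (divides 0 ≡.refl)
even⊎odd (suc n) with even⊎odd n
... | inj₁ (divides k n≡k*2) = inj₂ (k , ≡.cong suc n≡k*2)
... | inj₂ (k , n≡1+k*2)     = inj₁ (divides (suc k) (≡.cong suc n≡1+k*2))

prime^≥2 : ∀ {p} e → Prime p → 1 ≤ e → 2 ≤ p ℕ.^ e
prime^≥2 {p} (suc e) p-prime@(prime _) _ =
  ℕₚ.*-mono-≤ (ℕ.nonTrivial⇒n>1 p) (ℕₚ.m^n>0 p {{prime⇒nonZero p-prime}} e)

range-suc : ∀ {a n i} → suc a ≤ i → i < suc a ℕ.+ n → a ≤ i × i < a ℕ.+ suc n
range-suc {a} {n} {i} a<i i<1+a+n = ℕₚ.<⇒≤ a<i , ≡.subst (i <_) (≡.sym (ℕₚ.+-suc a n)) i<1+a+n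

module FieldProperties {c ℓ} (F : Field c ℓ) where
  open Field F
  open RingProperties ring
    using (-‿distribˡ-*; -‿distribʳ-*; -‿involutive; -1*x≈-x; ⁻¹-anti-homo‿-; [y-z]x≈yx-zx; +-inverseˡ-unique; x∙y⁻¹≈ε⇒x≈y; -0#≈0#)
  private module Exp = CommutativeSemiringExp commutativeSemiring
  open CommutativeSemigroupProperties *-commutativeSemigroup using (interchange; x∙yz≈y∙xz)
  open import Relation.Binary.Reasoning.Setoid setoid

  -- Field's _^_ unfolds like the library's semiring power, so the library's power laws transfer.
  ^≡Exp^ : ∀ x n → x ^ n ≡ x Exp.^ n
  ^≡Exp^ x zero    = ≡.refl
  ^≡Exp^ x (suc n) = ≡.cong (x *_) (^≡Exp^ x n)

  private
    transport : ∀ {x y x′ y′} → x ≡ x′ → y ≡ y′ → x′ ≈ y′ → x ≈ y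
    transport ≡.refl ≡.refl x≈y = x≈y

  ^-congˡ : ∀ n {x y} → x ≈ y → x ^ n ≈ y ^ n
  ^-congˡ n {x} {y} x≈y = transport (^≡Exp^ x n) (^≡Exp^ y n) (Exp.^-congˡ n x≈y)

  ^-congʳ : ∀ x {m n} → m ≡ n → x ^ m ≈ x ^ n
  ^-congʳ x ≡.refl = refl

  ^-homo-* : ∀ x m n → x ^ (m ℕ.+ n) ≈ x ^ m * x ^ n
  ^-homo-* x m n = transport (^≡Exp^ x (m ℕ.+ n)) (≡.cong₂ _*_ (^≡Exp^ x m) (^≡Exp^ x n)) (Exp.^-homo-* x m n)

  ^-assocʳ : ∀ x m n → (x ^ m) ^ n ≈ x ^ (m ℕ.* n)
  ^-assocʳ x m n = transport (≡.trans (^≡Exp^ (x ^ m) n) (≡.cong (Exp._^ n) (^≡Exp^ x m))) (^≡Exp^ x (m ℕ.* n))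
                             (Exp.^-assocʳ x m n)

  ^-distrib-* : ∀ x y n → (x * y) ^ n ≈ x ^ n * y ^ n
  ^-distrib-* x y n = transport (^≡Exp^ (x * y) n) (≡.cong₂ _*_ (^≡Exp^ x n) (^≡Exp^ y n)) (Exp.^-distrib-* x y n)

  -1^[k*2]≈1 : ∀ k → (- 1#) ^ (k ℕ.* 2) ≈ 1#
  -1^[k*2]≈1 zero    = refl
  -1^[k*2]≈1 (suc k) = begin
    - 1# * (- 1# * (- 1#) ^ (k ℕ.* 2)) ≈⟨ *-congˡ (*-congˡ (-1^[k*2]≈1 k)) ⟩
    - 1# * (- 1# * 1#)                 ≈⟨ *-congˡ (*-identityʳ (- 1#)) ⟩
    - 1# * - 1#                        ≈⟨ -1*x≈-x (- 1#) ⟩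
    - - 1#                             ≈⟨ -‿involutive 1# ⟩
    1#                                 ∎

  -1^p≈-1 : ∀ {p} → Prime p → ι p ≈ 0# → (- 1#) ^ p ≈ - 1#
  -1^p≈-1 {p} p-prime ιp≈0 with even⊎odd p
  ... | inj₂ (k , ≡.refl) = trans (*-congˡ (-1^[k*2]≈1 k)) (*-identityʳ (- 1#))
  ... | inj₁ 2∣p with prime⇒irreducible p-prime 2∣p
  ...   | inj₁ ()
  ...   | inj₂ ≡.refl = trans (-1^[k*2]≈1 1) 1≈-1
    where
    1≈-1 : 1# ≈ - 1#
    1≈-1 = +-inverseˡ-unique 1# 1# (trans (+-congˡ (sym (+-identityʳ 1#))) ιp≈0)

  -1^[n^k]≈-1 : ∀ n → (- 1#) ^ n ≈ - 1# → ∀ k → (- 1#) ^ (n ℕ.^ k) ≈ - 1#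
  -1^[n^k]≈-1 n -1^n≈-1 zero    = *-identityʳ (- 1#)
  -1^[n^k]≈-1 n -1^n≈-1 (suc k) = begin
    (- 1#) ^ (n ℕ.* n ℕ.^ k) ≈⟨ sym (^-assocʳ (- 1#) n (n ℕ.^ k)) ⟩
    ((- 1#) ^ n) ^ (n ℕ.^ k) ≈⟨ ^-congˡ (n ℕ.^ k) -1^n≈-1 ⟩
    (- 1#) ^ (n ℕ.^ k)       ≈⟨ -1^[n^k]≈-1 n -1^n≈-1 k ⟩
    - 1#                     ∎

  -‿^-odd : ∀ n → (- 1#) ^ n ≈ - 1# → ∀ x → (- x) ^ n ≈ - (x ^ n)
  -‿^-odd n -1^n≈-1 x = begin
    (- x) ^ n          ≈⟨ ^-congˡ n (sym (-1*x≈-x x)) ⟩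
    (- 1# * x) ^ n     ≈⟨ ^-distrib-* (- 1#) x n ⟩
    (- 1#) ^ n * x ^ n ≈⟨ *-congʳ -1^n≈-1 ⟩
    - 1# * x ^ n       ≈⟨ -1*x≈-x (x ^ n) ⟩
    - (x ^ n)          ∎

  ⁻¹-inverseˡ : ∀ {x} → x ≉ 0# → x ⁻¹ * x ≈ 1#
  ⁻¹-inverseˡ {x} x≉0 = trans (*-comm (x ⁻¹) x) (⁻¹-inverse x x≉0)

  ⁻¹-cancelˡ : ∀ {x} → x ≉ 0# → ∀ y → x ⁻¹ * (x * y) ≈ y
  ⁻¹-cancelˡ {x} x≉0 y = begin
    x ⁻¹ * (x * y) ≈⟨ sym (*-assoc (x ⁻¹) x y) ⟩
    x ⁻¹ * x * y   ≈⟨ *-congʳ (⁻¹-inverseˡ x≉0) ⟩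
    1# * y         ≈⟨ *-identityˡ y ⟩
    y              ∎

  *-≉0 : ∀ {x y} → x ≉ 0# → y ≉ 0# → x * y ≉ 0#
  *-≉0 {x} {y} x≉0 y≉0 xy≈0 = y≉0 (begin
    y              ≈⟨ sym (⁻¹-cancelˡ x≉0 y) ⟩
    x ⁻¹ * (x * y) ≈⟨ *-congˡ xy≈0 ⟩
    x ⁻¹ * 0#      ≈⟨ zeroʳ (x ⁻¹) ⟩
    0#             ∎)

  ⁻¹-≉0 : ∀ {x} → x ≉ 0# → x ⁻¹ ≉ 0#
  ⁻¹-≉0 {x} x≉0 x⁻¹≈0 = 0≉1 (begin
    0#       ≈⟨ sym (zeroʳ x) ⟩
    x * 0#   ≈⟨ *-congˡ (sym x⁻¹≈0) ⟩
    x * x ⁻¹ ≈⟨ ⁻¹-inverse x x≉0 ⟩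
    1#       ∎)

  1≉0 : 1# ≉ 0#
  1≉0 1≈0 = 0≉1 (sym 1≈0)

  ^-≉0 : ∀ {x} n → x ≉ 0# → x ^ n ≉ 0#
  ^-≉0 zero    x≉0 = 1≉0
  ^-≉0 (suc n) x≉0 = *-≉0 x≉0 (^-≉0 n x≉0)

  ^-≉0⇒≉0 : ∀ {x} n .{{_ : NonZero n}} → x ^ n ≉ 0# → x ≉ 0#
  ^-≉0⇒≉0 {x} (suc n) xⁿ≉0 x≈0 = xⁿ≉0 (trans (*-congʳ x≈0) (zeroˡ (x ^ n)))

  -‿≉0 : ∀ {x} → x ≉ 0# → - x ≉ 0#
  -‿≉0 {x} x≉0 -x≈0 = x≉0 (trans (sym (-‿involutive x)) (trans (-‿cong -x≈0) -0#≈0#))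

  cross-multiply : ∀ {x y z w v} → y ≉ 0# → v ≉ 0# → x * v ≈ z * (y * w) → x / y ≈ z * w / v
  cross-multiply {x} {y} {z} {w} {v} y≉0 v≉0 xv≈z[yw] = begin
    x * y ⁻¹                    ≈⟨ sym (*-identityʳ (x * y ⁻¹)) ⟩
    x * y ⁻¹ * 1#               ≈⟨ *-congˡ (sym (⁻¹-inverse v v≉0)) ⟩
    x * y ⁻¹ * (v * v ⁻¹)       ≈⟨ interchange x (y ⁻¹) v (v ⁻¹) ⟩
    x * v * (y ⁻¹ * v ⁻¹)       ≈⟨ *-congʳ (trans xv≈z[yw] (x∙yz≈y∙xz z y w)) ⟩
    y * (z * w) * (y ⁻¹ * v ⁻¹) ≈⟨ interchange y (z * w) (y ⁻¹) (v ⁻¹) ⟩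
    y * y ⁻¹ * (z * w * v ⁻¹)   ≈⟨ *-congʳ (⁻¹-inverse y y≉0) ⟩
    1# * (z * w * v ⁻¹)         ≈⟨ *-identityˡ (z * w * v ⁻¹) ⟩
    z * w * v ⁻¹                ∎

  ^ℤ-*-^ : ∀ {x} → x ≉ 0# → ∀ z b c → z ℤ.+ + b ≡ + c → x ^ℤ z * x ^ b ≈ x ^ c
  ^ℤ-*-^ {x} x≉0 (+ a)      b c a+b≡c = trans (sym (^-homo-* x a b)) (^-congʳ x (ℤₚ.+-injective a+b≡c))
  ^ℤ-*-^ {x} x≉0 -[1+ k ]   b c -k-1+b≡c = begin
    (x ^ suc k) ⁻¹ * x ^ b                   ≈⟨ *-congˡ (^-congʳ x b≡1+k+c) ⟩
    (x ^ suc k) ⁻¹ * x ^ (suc k ℕ.+ c)       ≈⟨ *-congˡ (^-homo-* x (suc k) c) ⟩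
    (x ^ suc k) ⁻¹ * (x ^ suc k * x ^ c)     ≈⟨ ⁻¹-cancelˡ (^-≉0 (suc k) x≉0) (x ^ c) ⟩
    x ^ c                                    ∎
    where
    open ℤ-Solver.+-*-Solver
    b≡1+k+c : b ≡ suc k ℕ.+ c
    b≡1+k+c = ℤₚ.+-injective (≡.trans (solve 2 (λ K B → B := K :+ (:- K :+ B)) ≡.refl (+ suc k) (+ b))
                                        (≡.cong (λ w → + suc k ℤ.+ w) -k-1+b≡c))

  ∏from-cong : ∀ a n {f g} → (∀ i → a ≤ i → i < a ℕ.+ n → f i ≈ g i) → ∏from a n f ≈ ∏from a n g
  ∏from-cong a zero    f≈g = refl
  ∏from-cong a (suc n) f≈g = *-cong (f≈g a ℕₚ.≤-refl (ℕₚ.m<m+n a (s≤s z≤n)))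
    (∏from-cong (suc a) n (λ i a<i i<1+a+n → let (a≤i , i<a+1+n) = range-suc a<i i<1+a+n in f≈g i a≤i i<a+1+n))

  ∏from-≉0 : ∀ a n {f} → (∀ i → a ≤ i → i < a ℕ.+ n → f i ≉ 0#) → ∏from a n f ≉ 0#
  ∏from-≉0 a zero    f≉0 = 1≉0
  ∏from-≉0 a (suc n) f≉0 = *-≉0 (f≉0 a ℕₚ.≤-refl (ℕₚ.m<m+n a (s≤s z≤n)))
    (∏from-≉0 (suc a) n (λ i a<i i<1+a+n → let (a≤i , i<a+1+n) = range-suc a<i i<1+a+n in f≉0 i a≤i i<a+1+n))

  ∏from-distrib-* : ∀ a n f g → ∏from a n f * ∏from a n g ≈ ∏from a n (λ i → f i * g i)
  ∏from-distrib-* a zero    f g = *-identityˡ 1#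
  ∏from-distrib-* a (suc n) f g =
    trans (interchange (f a) _ (g a) _) (*-congˡ (∏from-distrib-* (suc a) n f g))

  ∏from-^ : ∀ x a n f → ∏from a n (λ i → x ^ f i) ≈ x ^ Σfrom a n f
  ∏from-^ x a zero    f = refl
  ∏from-^ x a (suc n) f = trans (*-congˡ (∏from-^ x (suc a) n f)) (sym (^-homo-* x (f a) (Σfrom (suc a) n f)))

  ∏Fin-distrib-* : ∀ n f g → ∏Fin n f * ∏Fin n g ≈ ∏Fin n (λ j → f j * g j)
  ∏Fin-distrib-* zero    f g = *-identityˡ 1#
  ∏Fin-distrib-* (suc n) f g =
    trans (interchange (f Fin.zero) _ (g Fin.zero) _) (*-congˡ (∏Fin-distrib-* n (f ∘ Fin.suc) (g ∘ Fin.suc)))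

  ∏Fin-const : ∀ n {f x} → (∀ j → f j ≈ x) → ∏Fin n f ≈ x ^ n
  ∏Fin-const zero    f≈x = refl
  ∏Fin-const (suc n) f≈x = *-cong (f≈x Fin.zero) (∏Fin-const n (f≈x ∘ Fin.suc))

  ∏Fin-≉0 : ∀ n {f} → (∀ j → f j ≉ 0#) → ∏Fin n f ≉ 0#
  ∏Fin-≉0 zero    f≉0 = 1≉0
  ∏Fin-≉0 (suc n) f≉0 = *-≉0 (f≉0 Fin.zero) (∏Fin-≉0 n (f≉0 ∘ Fin.suc))

  [1-a/v]*v≈v-a : ∀ {v} → v ≉ 0# → ∀ a → (1# - a / v) * v ≈ v - a
  [1-a/v]*v≈v-a {v} v≉0 a = begin
    (1# - a * v ⁻¹) * v      ≈⟨ [y-z]x≈yx-zx v 1# (a * v ⁻¹) ⟩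
    1# * v - a * v ⁻¹ * v    ≈⟨ +-cong (*-identityˡ v) (-‿cong (trans (*-assoc a (v ⁻¹) v) (*-congˡ (⁻¹-inverseˡ v≉0)))) ⟩
    v - a * 1#               ≈⟨ +-congˡ (-‿cong (*-identityʳ a)) ⟩
    v - a                    ∎

  1-a/v≉0 : ∀ {v a} → v ≉ 0# → v ≉ a → 1# - a / v ≉ 0#
  1-a/v≉0 {v} {a} v≉0 v≉a 1-a/v≈0 = v≉a (x∙y⁻¹≈ε⇒x≈y v a (begin
    v - a               ≈⟨ sym ([1-a/v]*v≈v-a v≉0 a) ⟩
    (1# - a / v) * v    ≈⟨ *-congʳ 1-a/v≈0 ⟩
    0# * v              ≈⟨ zeroˡ v ⟩
    0#                  ∎))

  [1-a/v]⁻¹*[a-v]≈-v : ∀ {v a} → v ≉ 0# → v ≉ a → (1# - a / v) ⁻¹ * (a - v) ≈ - v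
  [1-a/v]⁻¹*[a-v]≈-v {v} {a} v≉0 v≉a = begin
    u ⁻¹ * (a - v)           ≈⟨ *-congˡ (sym (⁻¹-anti-homo‿- v a)) ⟩
    u ⁻¹ * - (v - a)         ≈⟨ *-congˡ (-‿cong (sym ([1-a/v]*v≈v-a v≉0 a))) ⟩
    u ⁻¹ * - (u * v)         ≈⟨ sym (-‿distribʳ-* (u ⁻¹) (u * v)) ⟩
    - (u ⁻¹ * (u * v))       ≈⟨ -‿cong (⁻¹-cancelˡ (1-a/v≉0 v≉0 v≉a) v) ⟩
    - v                      ∎
    where
    u : Carrier
    u = 1# - a / v

  a-v≉0 : ∀ {v a} → v ≉ a → a - v ≉ 0#
  a-v≉0 {v} {a} v≉a a-v≈0 = v≉a (sym (x∙y⁻¹≈ε⇒x≈y a v a-v≈0))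

module _ {c ℓ} (F : Field c ℓ) where
  open Field F

  module Periods
    {q : ℕ} (q≥2 : 2 ≤ q) (-1^q≈-1 : (- 1#) ^ q ≈ - 1#)
    (θ ρ : Carrier) (θ≉0 : θ ≉ 0#) (ρ^[q-1]≈-θ : ρ ^ (q ∸ 1) ≈ - θ) where

    open FieldProperties F
    open Objects F q θ ρ
    open RingProperties ring using (-‿distribˡ-*; -‿distribʳ-*; -‿involutive)
    open CommutativeSemigroupProperties *-commutativeSemigroup using (x∙yz≈y∙xz)
    open import Relation.Binary.Reasoning.Setoid setoid

    θq≉0 : ∀ i → θq i ≉ 0#
    θq≉0 i = ^-≉0 (q ℕ.^ i) θ≉0

    -θ≉0 : - θ ≉ 0#
    -θ≉0 = -‿≉0 θ≉0

    ρ≉0 : ρ ≉ 0#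
    ρ≉0 = ^-≉0⇒≉0 (q ∸ 1) {{ℕ.>-nonZero (ℕₚ.m<n⇒0<n∸m q≥2)}} (λ ρ^[q-1]≈0 → -θ≉0 (trans (sym ρ^[q-1]≈-θ) ρ^[q-1]≈0))

    [-θ]^[q^i]≈-θq : ∀ i → (- θ) ^ (q ℕ.^ i) ≈ - θq i
    [-θ]^[q^i]≈-θq i = -‿^-odd (q ℕ.^ i) (-1^[n^k]≈-1 q -1^q≈-1 i) θ

    ∏[1-t/θq]⁻¹*∏[t-θq] : ∀ t a n → (∀ i → a ≤ i → i < a ℕ.+ n → θq i ≉ t) →
      ∏from a n (λ i → (1# - t / θq i) ⁻¹) * ∏from a n (λ i → t - θq i) ≈ (- θ) ^ Σfrom a n (q ℕ.^_)
    ∏[1-t/θq]⁻¹*∏[t-θq] t a n θq≉t = begin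
      ∏from a n (λ i → (1# - t / θq i) ⁻¹) * ∏from a n (λ i → t - θq i)
        ≈⟨ ∏from-distrib-* a n _ _ ⟩
      ∏from a n (λ i → (1# - t / θq i) ⁻¹ * (t - θq i))
        ≈⟨ ∏from-cong a n (λ i a≤i i<a+n →
             trans ([1-a/v]⁻¹*[a-v]≈-v (θq≉0 i) (θq≉t i a≤i i<a+n)) (sym ([-θ]^[q^i]≈-θq i))) ⟩
      ∏from a n (λ i → (- θ) ^ (q ℕ.^ i))
        ≈⟨ ∏from-^ (- θ) a n (q ℕ.^_) ⟩
      (- θ) ^ Σfrom a n (q ℕ.^_) ∎

    π̃*l : ∀ d → 1 ≤ d → (∀ i → 1 ≤ i → i < d → θq i ≉ θ) →
          π̃ d * l (d ∸ 1) ≈ - (ρ * (- θ) ^ ℕ.suc (Σfrom 1 (d ∸ 1) (q ℕ.^_)))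
    π̃*l d d≥1 θq≉θ = begin
      θ * ρ * ∏from 1 (d ∸ 1) _ * ∏from 1 (d ∸ 1) _ ≈⟨ *-assoc (θ * ρ) _ _ ⟩
      θ * ρ * (∏from 1 (d ∸ 1) _ * ∏from 1 (d ∸ 1) _)
        ≈⟨ *-congˡ (∏[1-t/θq]⁻¹*∏[t-θq] θ 1 (d ∸ 1) (λ i 1≤i i<d → θq≉θ i 1≤i (≡.subst (i <_) (ℕₚ.m+[n∸m]≡n d≥1) i<d))) ⟩
      θ * ρ * x                ≈⟨ *-congʳ (*-comm θ ρ) ⟩
      ρ * θ * x                ≈⟨ *-assoc ρ θ x ⟩
      ρ * (θ * x)              ≈⟨ *-congˡ (sym (-‿involutive (θ * x))) ⟩
      ρ * - - (θ * x)          ≈⟨ *-congˡ (-‿cong (-‿distribˡ-* θ x)) ⟩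
      ρ * - (- θ * x)          ≈⟨ sym (-‿distribʳ-* ρ (- θ * x)) ⟩
      - (ρ * (- θ * x))        ∎
      where
      x : Carrier
      x = (- θ) ^ Σfrom 1 (d ∸ 1) (q ℕ.^_)

    ω*b : ∀ n t → (∀ i → i < n → t ≉ θq i) → ω n t * b n t ≈ ρ * (- θ) ^ Σfrom 0 n (q ℕ.^_)
    ω*b n t t≉θq = trans (*-assoc ρ _ _)
      (*-congˡ (∏[1-t/θq]⁻¹*∏[t-θq] t 0 n (λ i _ i<n θq≈t → t≉θq i i<n (sym θq≈t))))

    ρ^[1+m[q-1]] : ∀ m → ρ ^ (1 ℕ.+ m ℕ.* (q ∸ 1)) ≈ ρ * (- θ) ^ m
    ρ^[1+m[q-1]] m = *-congˡ (begin
      ρ ^ (m ℕ.* (q ∸ 1))   ≈⟨ ^-congʳ ρ (ℕₚ.*-comm m (q ∸ 1)) ⟩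
      ρ ^ ((q ∸ 1) ℕ.* m)   ≈⟨ sym (^-assocʳ ρ (q ∸ 1) m) ⟩
      (ρ ^ (q ∸ 1)) ^ m     ≈⟨ ^-congˡ m ρ^[q-1]≈-θ ⟩
      (- θ) ^ m             ∎)

    ∏ω*∏b : ∀ m n → let s = 1 ℕ.+ m ℕ.* (q ∸ 1) in (t : Fin s → Carrier) → (∀ j i → i < n → t j ≉ θq i) →
            ∏Fin s (λ j → ω n (t j)) * ∏Fin s (λ j → b n (t j)) ≈ ρ * (- θ) ^ (m ℕ.+ s ℕ.* Σfrom 0 n (q ℕ.^_))
    ∏ω*∏b m n t t≉θq = begin
      ∏Fin s (λ j → ω n (t j)) * ∏Fin s (λ j → b n (t j)) ≈⟨ ∏Fin-distrib-* s (λ j → ω n (t j)) (λ j → b n (t j)) ⟩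
      ∏Fin s (λ j → ω n (t j) * b n (t j))             ≈⟨ ∏Fin-const s (λ j → ω*b n (t j) (t≉θq j)) ⟩
      (ρ * (- θ) ^ S₀) ^ s                              ≈⟨ ^-distrib-* ρ ((- θ) ^ S₀) s ⟩
      ρ ^ s * ((- θ) ^ S₀) ^ s                          ≈⟨ *-cong (ρ^[1+m[q-1]] m) (^-assocʳ (- θ) S₀ s) ⟩
      ρ * (- θ) ^ m * (- θ) ^ (S₀ ℕ.* s)                ≈⟨ *-assoc ρ _ _ ⟩
      ρ * ((- θ) ^ m * (- θ) ^ (S₀ ℕ.* s))              ≈⟨ *-congˡ (sym (^-homo-* (- θ) m (S₀ ℕ.* s))) ⟩
      ρ * (- θ) ^ (m ℕ.+ S₀ ℕ.* s)                      ≈⟨ *-congˡ (^-congʳ (- θ) (≡.cong (m ℕ.+_) (ℕₚ.*-comm S₀ s))) ⟩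
      ρ * (- θ) ^ (m ℕ.+ s ℕ.* S₀)                      ∎
      where
      s S₀ : ℕ
      s  = 1 ℕ.+ m ℕ.* (q ∸ 1)
      S₀ = Σfrom 0 n (q ℕ.^_)

    l≉0 : ∀ d → 1 ≤ d → (∀ i → 1 ≤ i → i < d → θq i ≉ θ) → l (d ∸ 1) ≉ 0#
    l≉0 d d≥1 θq≉θ = ∏from-≉0 1 (d ∸ 1) (λ i 1≤i i<d → a-v≉0 (θq≉θ i 1≤i (≡.subst (i <_) (ℕₚ.m+[n∸m]≡n d≥1) i<d)))

    ∏ω≉0 : ∀ s n (t : Fin s → Carrier) → (∀ j i → i < n → t j ≉ θq i) → ∏Fin s (λ j → ω n (t j)) ≉ 0#
    ∏ω≉0 s n t t≉θq = ∏Fin-≉0 s (λ j → *-≉0 ρ≉0 (∏from-≉0 0 n (λ i _ i<n →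
      ⁻¹-≉0 (1-a/v≉0 (θq≉0 i) (λ θq≈t → t≉θq j i i<n (sym θq≈t))))))

lemma3 : ∀ {c ℓ} (F : Field c ℓ) → let open Field F in
    (p e q : ℕ) → Prime p → 1 ≤ e → q ≡ p ℕ.^ e → ι p ≈ 0# →
    (θ ρ : Carrier) → let open Objects F q θ ρ in
    ρ ^ (q ∸ 1) ≈ - θ → ¬ (θ ≈ 0#) →
    (m : ℕ) → 1 ≤ m → let s = 1 ℕ.+ m ℕ.* (q ∸ 1) in
    (d : ℕ) → m ≤ d → (t : Fin s → Carrier) →
    (∀ i → 1 ≤ i → i < d → ¬ (θq i ≈ θ)) →
    (∀ j i → i < d ∸ m → ¬ (t j ≈ θq i)) →
    π̃ d / ∏Fin s (λ j → ω (d ∸ m) (t j))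
      ≈ (- ((- θ) ^ℤ ((δ q m s d ℤ.- + m) ℤ.+ + 1))) * ∏Fin s (λ j → b (d ∸ m) (t j)) / l (d ∸ 1)
lemma3 F p e q p-prime e≥1 q≡pᵉ ιp≈0 θ ρ ρ^[q-1]≈-θ θ≉0 m m≥1 d m≤d t θq≉θ t≉θq =
  cross-multiply (∏ω≉0 s n t t≉θq) (l≉0 d d≥1 θq≉θ) (begin
    π̃ d * l (d ∸ 1)                 ≈⟨ π̃*l d d≥1 θq≉θ ⟩
    - (ρ * (- θ) ^ ℕ.suc S₁)         ≈⟨ -‿cong (*-congˡ (sym (^ℤ-*-^ -θ≉0 z k (ℕ.suc S₁) (δ-exponent q≥2 m s d d≥1)))) ⟩
    - (ρ * (E * (- θ) ^ k))          ≈⟨ -‿cong (x∙yz≈y∙xz ρ E _) ⟩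
    - (E * (ρ * (- θ) ^ k))          ≈⟨ -‿distribˡ-* E _ ⟩
    - E * (ρ * (- θ) ^ k)            ≈⟨ *-congˡ (sym (∏ω*∏b m n t t≉θq)) ⟩
    - E * (∏Fin s (λ j → ω n (t j)) * ∏Fin s (λ j → b n (t j))) ∎)
  where
  open Field F
  open FieldProperties F
  open Objects F q θ ρ
  open RingProperties ring using (-‿distribˡ-*)
  open CommutativeSemigroupProperties *-commutativeSemigroup using (x∙yz≈y∙xz)
  open import Relation.Binary.Reasoning.Setoid setoid
  q≥2 : 2 ≤ q
  q≥2 = ≡.subst (2 ≤_) (≡.sym q≡pᵉ) (prime^≥2 e p-prime e≥1)
  -1^q≈-1 : (- 1#) ^ q ≈ - 1#
  -1^q≈-1 = ≡.subst (λ n → (- 1#) ^ n ≈ - 1#) (≡.sym q≡pᵉ) (-1^[n^k]≈-1 p (-1^p≈-1 p-prime ιp≈0) e)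
  open Periods F q≥2 -1^q≈-1 θ ρ θ≉0 ρ^[q-1]≈-θ
  d≥1 : 1 ≤ d
  d≥1 = ℕₚ.≤-trans m≥1 m≤d
  s n S₁ k : ℕ
  s  = 1 ℕ.+ m ℕ.* (q ∸ 1)
  n  = d ∸ m
  S₁ = Σfrom 1 (d ∸ 1) (q ℕ.^_)
  k  = m ℕ.+ s ℕ.* Σfrom 0 n (q ℕ.^_)
  z : ℤ
  z  = (δ q m s d ℤ.- + m) ℤ.+ + 1
  E : Carrier
  E  = (- θ) ^ℤ z
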